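{- For $n\ge 2$ and $1\le k\le n$, let $a_{n,k}$ be the number of permutations $\pi$ of $[n]$ with $\pi_1=k$ that avoid the bi-vincular pattern $(123,\{0,2\},\emptyset)$. Then \[a_{n,k}=\begin{cases}(k-1)!\,k^{\,n-k}&\text{for }k=1,2,\dots,n-2,\\ (n-1)!&\text{if }k=n-1\text{ or }k=n.\end{cases}\]
   Context: A bi-vincular pattern of length $k$ is a triple $p=(\sigma,X,Y)$ with $\sigma$ a permutation of $[k]$ in one-line notation and $X,Y\subseteq\{0,1,\dots,k\}$. A permutation $\pi=\pi_1\cdots\pi_n$ of $[n]$ contains $p$ if there are indices $1\le i_1<\dots<i_k\le n$ such that $(\pi_{i_1},\dots,\pi_{i_k})$ is order-isomorphic to $\sigma$ and, writing $j_1<\dots<j_k$ for the set $\{\pi_{i_1},\dots,\pi_{i_k}\}$ in increasing order and setting $i_0=j_0=0$, $i_{k+1}=j_{k+1}=n+1$, we have $i_{x+1}=i_x+1$ for all $x\in X$ and $j_{y+1}=j_y+1$ for all $y\in Y$. Otherwise $\pi$ avoids $p$. In particular $\pi$ contains $(123,\{0,2\},\emptyset)$ iff there is $j\ge2$ with $\pi_1<\pi_j<\pi_{j+1}$. -}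

module Defs where

open import Data.Nat using (ℕ; zero; suc; _+_; _<_; _≡ᵇ_)
open import Data.Fin using (Fin; toℕ; zero; suc)
open import Data.Vec using (Vec; lookup; _∷_; [])
open import Data.List using (List; _∷_; [])
open import Data.Empty using (⊥)
open import Data.List.Membership.Propositional using (_∈_)
open import Data.Product using (Σ; ∃; ∃-syntax; _×_)
open import Relation.Binary.PropositionalEquality using (_≡_)
open import Relation.Nullary using (¬_)
open import Function.Bundles using (_⇔_)
open import Function.Definitions using (Injective)

-- A permutation of [n] in one-line notation: a vector of length n with
-- entries in Fin n (entry value v stands for v+1 ∈ [n]) which is injective.
IsPerm : ∀ {n} → Vec (Fin n) n → Set
IsPerm {n} π = Injective _≡_ _≡_ (lookup π)

-- Bi-vincular pattern of length m: (σ , X , Y), X,Y ⊆ {0,…,m} given as lists.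
record BiVincular (m : ℕ) : Set where
  constructor bv
  field
    σ : Vec (Fin m) m
    X : List ℕ
    Y : List ℕ

-- Boundary-extended 1-based sequence: Ext m N key f x u  means  "e_x = u", where
-- e_0 = 0, e_{key(a)+1} = f a for a : Fin m, e_{m+1} = N.
-- For the index sequence key = toℕ (i_{a+1} at slot a+1); for the sorted value
-- sequence key = σ (the occurrence is order-isomorphic to σ, so the entry at
-- pattern position a has rank σ_a, i.e. j_{σ_a} = π_{i_a} in 1-based terms).
data Ext (m N : ℕ) (key : Fin m → ℕ) (f : Fin m → ℕ) : ℕ → ℕ → Set where
  ext-zero : Ext m N key f 0 0
  ext-last : Ext m N key f (suc m) N
  ext-mid  : (a : Fin m) → Ext m N key f (suc (key a)) (f a)

Adjacent : ∀ {m} → ℕ → (Fin m → ℕ) → (Fin m → ℕ) → ℕ → Set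
Adjacent {m} N key f x = ∀ u v → Ext m N key f x u → Ext m N key f (suc x) v → v ≡ suc u

-- Containment of a bi-vincular pattern p = (σ,X,Y) of length m in π ∈ S_n.
-- pos a = i_{a+1} - 1 (0-based positions, strictly increasing); all
-- sequences below are converted to the paper's 1-based values.
Contains : ∀ {n m} → Vec (Fin n) n → BiVincular m → Set
Contains {n} {m} π (bv σ X Y) =
  Σ (Fin m → Fin n) λ pos →
    (∀ a b → toℕ a < toℕ b → toℕ (pos a) < toℕ (pos b)) ×
    (∀ a b → (toℕ (lookup π (pos a)) < toℕ (lookup π (pos b))) ⇔ (toℕ (lookup σ a) < toℕ (lookup σ b))) ×
    (∀ x → x ∈ X → Adjacent (suc n) toℕ (λ a → suc (toℕ (pos a))) x) ×
    (∀ y → y ∈ Y → Adjacent (suc n) (λ a → toℕ (lookup σ a)) (λ a → suc (toℕ (lookup π (pos a)))) y)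

Avoids : ∀ {n m} → Vec (Fin n) n → BiVincular m → Set
Avoids π p = ¬ Contains π p

p123 : BiVincular 3
p123 = bv (zero ∷ suc zero ∷ suc (suc zero) ∷ []) (0 ∷ 2 ∷ []) []

HasCount : {A : Set} → (A → Set) → ℕ → Set
HasCount {A} P c =
  Σ (Fin c → A) λ e → Injective _≡_ _≡_ e × (∀ i → P (e i)) × (∀ x → P x → ∃[ i ] e i ≡ x)

-- Permutations π of [n] with π_1 = k avoiding (123,{0,2},∅).
-- (Entry of Fin n with value v represents v+1, so π_1 = k means toℕ π[0] + 1 = k.)
A-set : (n k : ℕ) → Vec (Fin n) n → Set
A-set zero k π = ⊥
A-set (suc n) k π = IsPerm π × suc (toℕ (lookup π zero)) ≡ k × Avoids π p123

module Submission where

-- Use 0-based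
-- values and put h = k-1.  An occurrence must use π₁ (0 ∈ X) and two adjacent
-- later entries (2 ∈ X), so π avoids the pattern iff its tail has no adjacent
-- ascent x < y with h < x, an "ascent above h".  Encoding permutations of
-- {0,…,N-1} as lists of naturals, the lists starting with h without ascent
-- above h are counted by induction on N, through the maximal entry N-1:
--   * for N = h+1 the tail is any permutation of {0,…,h-1}, giving h! lists
--     (m! permutations is itself proved by inserting the maximum in one of m+1
--     places);
--   * for N > h+1 the maximum sits exactly right after one of the values
--     0,…,h, and inserting it there is a bijection, so the count is
--     multiplied by h+1.
-- Hence a_{n,h+1} = h!·(h+1)^(n-h-1), which equals (n-1)! for k ∈ {n-1, n}.

open import Defs
open import Data.Nat using (ℕ; zero; suc; _+_; _*_; _∸_; _^_; _!; _≤_; _<_; z≤n; s≤s; _≟_; _≤?_; s≤s⁻¹)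
open import Data.Nat.Properties
  using (≤-trans; ≤-refl; <-irrefl; <-asym; <-trans; ≤-<-trans; n≤1+n; ≤∧≢⇒<; ≰⇒>; <-cmp;
         suc-injective; m≤n+m; m∸n+n≡m; m+n∸n≡m; n∸n≡0; *-identityʳ; *-comm; *-assoc)
open import Data.Fin using (Fin; toℕ; fromℕ<; combine; remQuot) renaming (zero to fz; suc to fs)
open import Data.Fin.Properties using (toℕ-injective; toℕ-fromℕ<; toℕ<n; remQuot-combine; combine-remQuot)
import Data.Fin.Properties as Fin
open import Data.List using (List; []; _∷_; length; downFrom)
open import Data.List.Properties using (length-downFrom; ∷-injectiveˡ; ∷-injectiveʳ)
open import Data.List.Membership.Propositional using (_∈_; _∉_)
open import Data.List.Membership.Propositional.Properties using (∈-downFrom⁺)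
open import Data.List.Membership.DecPropositional _≟_ using (_∈?_)
open import Data.List.Relation.Unary.Any using (here; there)
open import Data.Vec using (Vec; lookup) renaming (_∷_ to _∷v_; [] to []v)
open import Data.Maybe using (Maybe; just; nothing)
open import Data.Maybe.Properties using (just-injective)
open import Data.Product using (Σ; _×_; _,_; proj₁; proj₂; uncurry)
open import Data.Sum using (_⊎_; inj₁; inj₂; [_,_]′)
open import Data.Empty using (⊥; ⊥-elim)
open import Data.Unit using (⊤; tt)
open import Relation.Nullary using (¬_; yes; no)
open import Relation.Binary.Definitions using (tri<; tri≈; tri>)
open import Relation.Binary.PropositionalEquality
  using (_≡_; _≢_; refl; sym; trans; cong; cong₂; subst; subst₂; module ≡-Reasoning)
open import Function.Bundles using (_⇔_; mk⇔; Equivalence)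
open import Function.Definitions using (Injective)
open ≡-Reasoning

module _ {A B : Set} {P : A → Set} {Q : B → Set} {c : ℕ} where

  HasCount-map : HasCount P c → (f : A → B) →
    (∀ x y → P x → P y → f x ≡ f y → x ≡ y) → (∀ x → P x → Q (f x)) →
    (∀ y → Q y → Σ A λ x → P x × f x ≡ y) → HasCount Q c
  HasCount-map (e , inj , pe , su) f finj fq fsurj =
    (λ i → f (e i)) ,
    (λ {i} {j} eq → inj (finj (e i) (e j) (pe i) (pe j) eq)) ,
    (λ i → fq (e i) (pe i)) ,
    λ y qy → let (x , px , fx≡y) = fsurj y qy ; (i , ei≡x) = su x px in i , trans (cong f ei≡x) fx≡y

  HasCount-comap : HasCount P c → (g : B → A) →
    (∀ x y → Q x → Q y → g x ≡ g y → x ≡ y) → (∀ y → Q y → P (g y)) →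
    (∀ x → P x → Σ B λ y → Q y × g y ≡ x) → HasCount Q c
  HasCount-comap (e , inj , pe , su) g ginj gp gsurj =
    (λ i → preimage i) ,
    (λ {i} {j} eq → inj (trans (sym (g-preimage i)) (trans (cong g eq) (g-preimage j)))) ,
    (λ i → proj₁ (proj₂ (gsurj (e i) (pe i)))) ,
    λ y qy → let (i , ei≡gy) = su (g y) (gp y qy)
                 (y' , qy' , gy'≡ei) = gsurj (e i) (pe i)
             in i , ginj y' y qy' qy (trans gy'≡ei ei≡gy)
    where
    preimage : Fin c → B
    preimage i = proj₁ (gsurj (e i) (pe i))
    g-preimage : ∀ i → g (preimage i) ≡ e i
    g-preimage i = proj₂ (proj₂ (gsurj (e i) (pe i)))

HasCount-× : {A : Set} {P : A → Set} {a : ℕ} (q : ℕ) → HasCount P a →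
  HasCount {Fin q × A} (λ p → P (proj₂ p)) (q * a)
HasCount-× {a = a} q (e , inj , pe , su) =
  (λ i → proj₁ (split i) , e (proj₂ (split i))) ,
  (λ {i} {j} eq → trans (sym (combine-remQuot {q} a i))
     (trans (cong (uncurry combine) (cong₂ _,_ (cong proj₁ eq) (inj (cong proj₂ eq))))
            (combine-remQuot {q} a j))) ,
  (λ i → pe (proj₂ (split i))) ,
  λ { (c , x) px → let (j , ej≡x) = su x px in combine {q} {a} c j ,
        trans (cong (λ p → proj₁ p , e (proj₂ p)) (remQuot-combine {q} {a} c j)) (cong (c ,_) ej≡x) }
  where
  split : Fin (q * a) → Fin q × Fin a
  split = remQuot {q} a

Distinct : List ℕ → Set
Distinct [] = ⊤
Distinct (x ∷ l) = x ∉ l × Distinct l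

PermList : ℕ → List ℕ → Set
PermList n l = length l ≡ n × Distinct l × (∀ x → x ∈ l → x < n)

remove : ℕ → List ℕ → List ℕ
remove v [] = []
remove v (y ∷ l) with y ≟ v
... | yes _ = l
... | no _ = y ∷ remove v l

remove-length : ∀ v l → v ∈ l → suc (length (remove v l)) ≡ length l
remove-length v (y ∷ l) v∈l with y ≟ v
... | yes _ = refl
... | no y≢v with v∈l
...   | here v≡y = ⊥-elim (y≢v (sym v≡y))
...   | there v∈l' = cong suc (remove-length v l v∈l')

remove-⊆ : ∀ v l x → x ∈ remove v l → x ∈ l
remove-⊆ v (y ∷ l) x x∈ with y ≟ v
... | yes _ = there x∈
remove-⊆ v (y ∷ l) x (here x≡y) | no _ = here x≡y
remove-⊆ v (y ∷ l) x (there x∈) | no _ = there (remove-⊆ v l x x∈)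

remove-≢ : ∀ v l x → Distinct l → x ∈ remove v l → x ≢ v
remove-≢ v (y ∷ l) x (y∉l , _) x∈ with y ≟ v
... | yes refl = λ { refl → y∉l x∈ }
remove-≢ v (y ∷ l) x _ (here refl) | no y≢v = y≢v
remove-≢ v (y ∷ l) x (_ , dl) (there x∈) | no _ = remove-≢ v l x dl x∈

remove-keeps : ∀ v l x → x ∈ l → x ≢ v → x ∈ remove v l
remove-keeps v (y ∷ l) x x∈ x≢v with y ≟ v
remove-keeps v (y ∷ l) x (here refl) x≢v | yes refl = ⊥-elim (x≢v refl)
remove-keeps v (y ∷ l) x (there x∈) x≢v | yes _ = x∈
remove-keeps v (y ∷ l) x (here x≡y) x≢v | no _ = here x≡y
remove-keeps v (y ∷ l) x (there x∈) x≢v | no _ = there (remove-keeps v l x x∈ x≢v)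

remove-distinct : ∀ v l → Distinct l → Distinct (remove v l)
remove-distinct v [] _ = tt
remove-distinct v (y ∷ l) (y∉l , dl) with y ≟ v
... | yes _ = dl
... | no _ = (λ y∈ → y∉l (remove-⊆ v l y y∈)) , remove-distinct v l dl

distinct-length-≤ : ∀ s l → Distinct l → (∀ x → x ∈ l → x ∈ s) → length l ≤ length s
distinct-length-≤ [] [] _ _ = z≤n
distinct-length-≤ [] (y ∷ l) _ l⊆s with l⊆s y (here refl)
... | ()
distinct-length-≤ (y ∷ s) l dl l⊆s with y ∈? l
... | yes y∈l = subst (_≤ suc (length s)) (remove-length y l y∈l)
        (s≤s (distinct-length-≤ s (remove y l) (remove-distinct y l dl) rest⊆s))
  where
  rest⊆s : ∀ x → x ∈ remove y l → x ∈ s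
  rest⊆s x x∈ with l⊆s x (remove-⊆ y l x x∈)
  ... | here x≡y = ⊥-elim (remove-≢ y l x dl x∈ x≡y)
  ... | there x∈s = x∈s
... | no y∉l = ≤-trans (distinct-length-≤ s l dl l⊆s') (n≤1+n _)
  where
  l⊆s' : ∀ x → x ∈ l → x ∈ s
  l⊆s' x x∈ with l⊆s x x∈
  ... | here refl = ⊥-elim (y∉l x∈)
  ... | there x∈s = x∈s

-- A permutation list of {0,…,n-1} contains every x < n: otherwise it would fit,
-- without repetitions, inside the n-1 remaining values.
permList-∋ : ∀ n l x → PermList n l → x < n → x ∈ l
permList-∋ n l x (len , dl , bounded) x<n with x ∈? l
... | yes x∈l = x∈l
... | no x∉l = ⊥-elim (<-irrefl refl (subst (_≤ length others) others-length too-long))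
  where
  others : List ℕ
  others = remove x (downFrom n)
  too-long : n ≤ length others
  too-long = subst (_≤ length others) len (distinct-length-≤ others l dl
    (λ y y∈l → remove-keeps x (downFrom n) y (∈-downFrom⁺ (bounded y y∈l)) (λ { refl → x∉l y∈l })))
  others-length : n ≡ suc (length others)
  others-length = sym (trans (remove-length x (downFrom n) (∈-downFrom⁺ x<n)) (length-downFrom n))

permList-∌ : ∀ n l → PermList n l → n ∉ l
permList-∌ n l (_ , _ , bounded) n∈l = <-irrefl refl (bounded n n∈l)

insertAfter : Maybe ℕ → ℕ → List ℕ → List ℕ
insertAfter nothing v l = v ∷ l
insertAfter (just x) v [] = []
insertAfter (just x) v (y ∷ l) with y ≟ x
... | yes _ = y ∷ v ∷ l
... | no _ = y ∷ insertAfter (just x) v l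

-- The anchor of v in p ∷ l (with p = nothing meaning "v is at the front"),
-- i.e. the entry immediately before v; predecessor v l is its value in l.
predecessorAfter : Maybe ℕ → ℕ → List ℕ → Maybe ℕ
predecessorAfter p v [] = nothing
predecessorAfter p v (y ∷ l) with y ≟ v
... | yes _ = p
... | no _ = predecessorAfter (just y) v l

predecessor : ℕ → List ℕ → Maybe ℕ
predecessor v l = predecessorAfter nothing v l

AnchorIn : Maybe ℕ → List ℕ → Set
AnchorIn nothing l = ⊤
AnchorIn (just x) l = x ∈ l

insertAfter-length : ∀ s v l → AnchorIn s l → length (insertAfter s v l) ≡ suc (length l)
insertAfter-length nothing v l _ = refl
insertAfter-length (just x) v (y ∷ l) x∈ with y ≟ x
... | yes _ = refl
... | no y≢x with x∈
...   | here x≡y = ⊥-elim (y≢x (sym x≡y))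
...   | there x∈l = cong suc (insertAfter-length (just x) v l x∈l)

insertAfter-∈ : ∀ s v l x → x ∈ insertAfter s v l → x ≡ v ⊎ x ∈ l
insertAfter-∈ nothing v l x (here x≡v) = inj₁ x≡v
insertAfter-∈ nothing v l x (there x∈) = inj₂ x∈
insertAfter-∈ (just w) v (y ∷ l) x x∈ with y ≟ w
insertAfter-∈ (just w) v (y ∷ l) x (here x≡y) | yes _ = inj₂ (here x≡y)
insertAfter-∈ (just w) v (y ∷ l) x (there (here x≡v)) | yes _ = inj₁ x≡v
insertAfter-∈ (just w) v (y ∷ l) x (there (there x∈)) | yes _ = inj₂ (there x∈)
insertAfter-∈ (just w) v (y ∷ l) x (here x≡y) | no _ = inj₂ (here x≡y)
insertAfter-∈ (just w) v (y ∷ l) x (there x∈) | no _ =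
  [ inj₁ , (λ x∈l → inj₂ (there x∈l)) ]′ (insertAfter-∈ (just w) v l x x∈)

insertAfter-distinct : ∀ s v l → Distinct l → v ∉ l → Distinct (insertAfter s v l)
insertAfter-distinct nothing v l dl v∉l = v∉l , dl
insertAfter-distinct (just w) v [] _ _ = tt
insertAfter-distinct (just w) v (y ∷ l) (y∉l , dl) v∉ with y ≟ w
... | yes _ = (λ { (here refl) → v∉ (here refl) ; (there y∈l) → y∉l y∈l }) , (λ v∈l → v∉ (there v∈l)) , dl
... | no _ = (λ y∈ → [ (λ { refl → v∉ (here refl) }) , y∉l ]′ (insertAfter-∈ (just w) v l y y∈)) ,
             insertAfter-distinct (just w) v l dl (λ v∈l → v∉ (there v∈l))

remove-insertAfter : ∀ s v l → v ∉ l → remove v (insertAfter s v l) ≡ l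
remove-insertAfter nothing v l v∉l with v ≟ v
... | yes _ = refl
... | no v≢v = ⊥-elim (v≢v refl)
remove-insertAfter (just x) v [] _ = refl
remove-insertAfter (just x) v (y ∷ l) v∉ with y ≟ x
... | yes _ with y ≟ v
...   | yes refl = ⊥-elim (v∉ (here refl))
...   | no _ with v ≟ v
...     | yes _ = refl
...     | no v≢v = ⊥-elim (v≢v refl)
remove-insertAfter (just x) v (y ∷ l) v∉ | no _ with y ≟ v
... | yes refl = ⊥-elim (v∉ (here refl))
... | no _ = cong (y ∷_) (remove-insertAfter (just x) v l (λ v∈l → v∉ (there v∈l)))

predecessorAfter-insertAfter : ∀ p x v l → x ∈ l → v ∉ l → predecessorAfter p v (insertAfter (just x) v l) ≡ just x
predecessorAfter-insertAfter p x v (y ∷ l) x∈ v∉ with y ≟ x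
... | yes refl with y ≟ v
...   | yes refl = ⊥-elim (v∉ (here refl))
...   | no _ with v ≟ v
...     | yes _ = refl
...     | no v≢v = ⊥-elim (v≢v refl)
predecessorAfter-insertAfter p x v (y ∷ l) x∈ v∉ | no y≢x with y ≟ v
... | yes refl = ⊥-elim (v∉ (here refl))
... | no _ with x∈
...   | here x≡y = ⊥-elim (y≢x (sym x≡y))
...   | there x∈l = predecessorAfter-insertAfter (just y) x v l x∈l (λ v∈l → v∉ (there v∈l))

predecessor-insertAfter : ∀ s v l → v ∉ l → AnchorIn s l → predecessor v (insertAfter s v l) ≡ s
predecessor-insertAfter nothing v l _ _ with v ≟ v
... | yes _ = refl
... | no v≢v = ⊥-elim (v≢v refl)
predecessor-insertAfter (just x) v l v∉l x∈l = predecessorAfter-insertAfter nothing x v l x∈l v∉l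

predecessorAfter-∈ : ∀ v p r → v ∈ r → Σ ℕ λ w → predecessorAfter (just p) v r ≡ just w × w ∈ p ∷ r
predecessorAfter-∈ v p (u ∷ r) v∈ with u ≟ v
... | yes _ = p , refl , here refl
... | no u≢v with v∈
...   | here v≡u = ⊥-elim (u≢v (sym v≡u))
...   | there v∈r = let (w , eq , w∈) = predecessorAfter-∈ v u r v∈r in w , eq , there w∈

predecessorAfter-cases : ∀ p v l x → predecessorAfter p v l ≡ just x → p ≡ just x ⊎ (x ∈ l × x ≢ v)
predecessorAfter-cases p v (z ∷ r) x eq with z ≟ v
... | yes _ = inj₁ eq
... | no z≢v with predecessorAfter-cases (just z) v r x eq
...   | inj₁ refl = inj₂ (here refl , z≢v)
...   | inj₂ (x∈r , x≢v) = inj₂ (there x∈r , x≢v)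

-- Removing an entry and re-inserting it after its predecessor gives back the
-- list.  The general form tracks an extra anchor p placed in front of l.
prepend : Maybe ℕ → List ℕ → List ℕ
prepend nothing l = l
prepend (just y) l = y ∷ l

FreshAnchor : ℕ → Maybe ℕ → List ℕ → Set
FreshAnchor v nothing l = ⊤
FreshAnchor v (just y) l = y ∉ l × y ≢ v

insertAfter-skip : ∀ y w v l → y ≢ w → insertAfter (just w) v (y ∷ l) ≡ y ∷ insertAfter (just w) v l
insertAfter-skip y w v l y≢w with y ≟ w
... | yes y≡w = ⊥-elim (y≢w y≡w)
... | no _ = refl

insertAfter-removeAfter : ∀ p v l → v ∈ l → Distinct l → FreshAnchor v p l →
  insertAfter (predecessorAfter p v l) v (prepend p (remove v l)) ≡ prepend p l
insertAfter-removeAfter p v (z ∷ r) v∈ (z∉r , dr) fresh with z ≟ v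
insertAfter-removeAfter nothing v (z ∷ r) v∈ _ fresh | yes refl = refl
insertAfter-removeAfter (just y) v (z ∷ r) v∈ _ fresh | yes refl with y ≟ y
... | yes _ = refl
... | no y≢y = ⊥-elim (y≢y refl)
insertAfter-removeAfter p v (z ∷ r) v∈ (z∉r , dr) fresh | no z≢v with v∈
... | here v≡z = ⊥-elim (z≢v (sym v≡z))
... | there v∈r with insertAfter-removeAfter (just z) v r v∈r dr (z∉r , z≢v)
insertAfter-removeAfter nothing v (z ∷ r) v∈ _ fresh | no z≢v | there v∈r | ih = ih
insertAfter-removeAfter (just y) v (z ∷ r) v∈ _ (y∉ , y≢v) | no z≢v | there v∈r | ih
  with predecessorAfter-∈ v z r v∈r
... | (w , eq , w∈) rewrite eq =
  trans (insertAfter-skip y w v (z ∷ remove v r) (λ y≡w → y∉ (subst (_∈ z ∷ r) (sym y≡w) w∈)))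
        (cong (y ∷_) ih)

insertAfter-remove : ∀ v l → v ∈ l → Distinct l → insertAfter (predecessor v l) v (remove v l) ≡ l
insertAfter-remove v l v∈l dl = insertAfter-removeAfter nothing v l v∈l dl tt

permList-insertAfter : ∀ N s l → PermList N l → AnchorIn s l → PermList (suc N) (insertAfter s N l)
permList-insertAfter N s l p@(len , dl , bounded) s∈l =
  trans (insertAfter-length s N l s∈l) (cong suc len) ,
  insertAfter-distinct s N l dl (permList-∌ N l p) ,
  λ x x∈ → [ (λ { refl → ≤-refl }) , (λ x∈l → <-trans (bounded x x∈l) ≤-refl) ]′ (insertAfter-∈ s N l x x∈)

permList-remove : ∀ N l → PermList (suc N) l → PermList N (remove N l)
permList-remove N l p@(len , dl , bounded) =
  suc-injective (trans (remove-length N l (permList-∋ (suc N) l N p ≤-refl)) len) ,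
  remove-distinct N l dl ,
  λ x x∈ → ≤∧≢⇒< (s≤s⁻¹ (bounded x (remove-⊆ N l x x∈))) (remove-≢ N l x dl x∈)

insertion-count : {P P' : List ℕ → Set} {a : ℕ} (q : ℕ) (anchor : Fin q → Maybe ℕ) (v : ℕ) →
  (∀ c c' → anchor c ≡ anchor c' → c ≡ c') →
  (∀ l → P l → v ∉ l) →
  (∀ l c → P l → AnchorIn (anchor c) l) →
  (∀ l c → P l → P' (insertAfter (anchor c) v l)) →
  (∀ l' → P' l' → v ∈ l' × Distinct l' × P (remove v l') × Σ (Fin q) λ c → anchor c ≡ predecessor v l') →
  HasCount P a → HasCount P' (q * a)
insertion-count {P} {P'} q anchor v anchor-inj v∉ anchored insert-ok split hc =
  HasCount-map (HasCount-× q hc) insert insert-injective (λ (c , l) pl → insert-ok l c pl) covers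
  where
  insert : Fin q × List ℕ → List ℕ
  insert (c , l) = insertAfter (anchor c) v l
  anchor-recovered : ∀ c l → P l → predecessor v (insert (c , l)) ≡ anchor c
  anchor-recovered c l pl = predecessor-insertAfter (anchor c) v l (v∉ l pl) (anchored l c pl)
  list-recovered : ∀ c l → P l → remove v (insert (c , l)) ≡ l
  list-recovered c l pl = remove-insertAfter (anchor c) v l (v∉ l pl)
  insert-injective : ∀ x y → P (proj₂ x) → P (proj₂ y) → insert x ≡ insert y → x ≡ y
  insert-injective (c , l) (c' , l') pl pl' eq = cong₂ _,_
    (anchor-inj c c' (trans (sym (anchor-recovered c l pl)) (trans (cong (predecessor v) eq) (anchor-recovered c' l' pl'))))
    (trans (sym (list-recovered c l pl)) (trans (cong (remove v) eq) (list-recovered c' l' pl')))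
  covers : ∀ l' → P' l' → Σ (Fin q × List ℕ) λ x → P (proj₂ x) × insert x ≡ l'
  covers l' pl' with split l' pl'
  ... | (v∈ , dl' , prm , c , c-anchor) = (c , remove v l') , prm ,
    trans (cong (λ s → insertAfter s v (remove v l')) c-anchor) (insertAfter-remove v l' v∈ dl')

anyAnchor : ∀ {m} → Fin (suc m) → Maybe ℕ
anyAnchor fz = nothing
anyAnchor (fs c) = just (toℕ c)

anyAnchor-injective : ∀ {m} (c c' : Fin (suc m)) → anyAnchor c ≡ anyAnchor c' → c ≡ c'
anyAnchor-injective fz fz _ = refl
anyAnchor-injective (fs c) (fs c') eq = cong fs (toℕ-injective (just-injective eq))

-- There are m! permutations of {0,…,m-1}: the maximum sits after any of the m+1 anchors.
permList-count : ∀ m → HasCount (PermList m) (m !)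
permList-count zero = (λ _ → []) , (λ { {fz} {fz} _ → refl }) , (λ _ → refl , tt , λ x ()) ,
  λ { [] _ → fz , refl ; (x ∷ l) (() , _) }
permList-count (suc m) = insertion-count (suc m) anyAnchor m anyAnchor-injective (permList-∌ m)
  anchored (λ l c p → permList-insertAfter m (anyAnchor c) l p (anchored l c p)) split (permList-count m)
  where
  anchored : ∀ l (c : Fin (suc m)) → PermList m l → AnchorIn (anyAnchor c) l
  anchored l fz p = tt
  anchored l (fs c) p = permList-∋ m l (toℕ c) p (toℕ<n c)
  anchorOf : ∀ l' → PermList (suc m) l' → Σ (Fin (suc m)) λ c → anyAnchor c ≡ predecessor m l'
  anchorOf l' (_ , _ , bounded) with predecessor m l' in eq
  ... | nothing = fz , refl
  ... | just x with predecessorAfter-cases nothing m l' x eq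
  ...   | inj₁ ()
  ...   | inj₂ (x∈ , x≢m) = fs (fromℕ< x<m) , cong just (toℕ-fromℕ< x<m)
    where x<m = ≤∧≢⇒< (s≤s⁻¹ (bounded x x∈)) x≢m
  split : ∀ l' → PermList (suc m) l' →
    m ∈ l' × Distinct l' × PermList m (remove m l') × Σ (Fin (suc m)) λ c → anyAnchor c ≡ predecessor m l'
  split l' p@(_ , dl' , _) = permList-∋ (suc m) l' m p ≤-refl , dl' , permList-remove m l' p , anchorOf l' p

AscentAbove : ℕ → List ℕ → Set
AscentAbove h [] = ⊥
AscentAbove h (x ∷ []) = ⊥
AscentAbove h (x ∷ y ∷ r) = (h < x × x < y) ⊎ AscentAbove h (y ∷ r)

-- The list form of the permutations counted by a_{N,h+1}: they start with h
-- and their tail has no ascent above h.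
Admissible : ℕ → ℕ → List ℕ → Set
Admissible N h [] = ⊥
Admissible N h (x ∷ t) = x ≡ h × PermList N (x ∷ t) × ¬ AscentAbove h t

module _ {h : ℕ} where

  ascent-∷ : ∀ y r → AscentAbove h r → AscentAbove h (y ∷ r)
  ascent-∷ y (z ∷ r) asc = inj₂ asc

  ascent-behind-head : ∀ t → AscentAbove h (h ∷ t) → AscentAbove h t
  ascent-behind-head (w ∷ r) (inj₁ (h<h , _)) = ⊥-elim (<-irrefl refl h<h)
  ascent-behind-head (w ∷ r) (inj₂ asc) = asc

  ascent-behind-max : ∀ N t → (∀ x → x ∈ t → x < N) → AscentAbove h (N ∷ t) → AscentAbove h t
  ascent-behind-max N (w ∷ r) bounded (inj₁ (_ , N<w)) = ⊥-elim (<-asym N<w (bounded w (here refl)))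
  ascent-behind-max N (w ∷ r) bounded (inj₂ asc) = asc

  ascent-insert-max : ∀ N z r → z ≤ h → (∀ x → x ∈ r → x < N) →
    AscentAbove h (z ∷ N ∷ r) → AscentAbove h (z ∷ r)
  ascent-insert-max N z r z≤h bounded (inj₁ (h<z , _)) = ⊥-elim (<-irrefl refl (≤-<-trans z≤h h<z))
  ascent-insert-max N z r z≤h bounded (inj₂ asc) = ascent-∷ z r (ascent-behind-max N r bounded asc)

  ascent-insertAfter-∷ : ∀ N c → c ≤ h → ∀ y r → (∀ x → x ∈ r → x < N) →
    AscentAbove h (y ∷ insertAfter (just c) N r) → AscentAbove h (y ∷ r)
  ascent-insertAfter-∷ N c c≤h y (z ∷ r) bounded asc with z ≟ c
  ascent-insertAfter-∷ N c c≤h y (z ∷ r) bounded (inj₁ yz) | yes refl = inj₁ yz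
  ascent-insertAfter-∷ N c c≤h y (z ∷ r) bounded (inj₂ asc) | yes refl =
    inj₂ (ascent-insert-max N z r c≤h (λ x x∈ → bounded x (there x∈)) asc)
  ascent-insertAfter-∷ N c c≤h y (z ∷ r) bounded (inj₁ yz) | no _ = inj₁ yz
  ascent-insertAfter-∷ N c c≤h y (z ∷ r) bounded (inj₂ asc) | no _ =
    inj₂ (ascent-insertAfter-∷ N c c≤h z r (λ x x∈ → bounded x (there x∈)) asc)

  ascent-insertAfter : ∀ N c → c ≤ h → ∀ t → (∀ x → x ∈ t → x < N) →
    AscentAbove h (insertAfter (just c) N t) → AscentAbove h t
  ascent-insertAfter N c c≤h (y ∷ r) bounded asc with y ≟ c
  ... | yes refl = ascent-insert-max N y r c≤h (λ x x∈ → bounded x (there x∈)) asc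
  ... | no _ = ascent-insertAfter-∷ N c c≤h y r (λ x x∈ → bounded x (there x∈)) asc

  -- Deleting the maximum N creates no new ascent: a new adjacency y, w comes with the ascent y < N.
  ascent-remove-∷ : ∀ N y r → y < N → (∀ x → x ∈ r → x ≤ N) →
    AscentAbove h (y ∷ remove N r) → AscentAbove h (y ∷ r)
  ascent-remove-∷ N y (z ∷ r) y<N bounded asc with z ≟ N
  ascent-remove-∷ N y (z ∷ w ∷ r) y<N bounded (inj₁ (h<y , _)) | yes refl = inj₁ (h<y , y<N)
  ascent-remove-∷ N y (z ∷ w ∷ r) y<N bounded (inj₂ asc) | yes refl = inj₂ (inj₂ asc)
  ascent-remove-∷ N y (z ∷ r) y<N bounded (inj₁ yz) | no _ = inj₁ yz
  ascent-remove-∷ N y (z ∷ r) y<N bounded (inj₂ asc) | no z≢N =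
    inj₂ (ascent-remove-∷ N z r (≤∧≢⇒< (bounded z (here refl)) z≢N) (λ x x∈ → bounded x (there x∈)) asc)

  ascent-remove : ∀ N t → (∀ x → x ∈ t → x ≤ N) → AscentAbove h (remove N t) → AscentAbove h t
  ascent-remove N (y ∷ r) bounded asc with y ≟ N
  ... | yes _ = ascent-∷ y r asc
  ... | no y≢N = ascent-remove-∷ N y r (≤∧≢⇒< (bounded y (here refl)) y≢N) (λ x x∈ → bounded x (there x∈)) asc

  ascent-at-predecessor : ∀ v y t x → predecessorAfter (just y) v t ≡ just x → h < x → x < v → AscentAbove h (y ∷ t)
  ascent-at-predecessor v y (z ∷ r) x eq h<x x<v with z ≟ v
  ascent-at-predecessor v y (z ∷ r) x refl h<x x<v | yes refl = inj₁ (h<x , x<v)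
  ... | no _ = ascent-∷ y (z ∷ r) (ascent-at-predecessor v z r x eq h<x x<v)

  ascent-entry-above : ∀ t → AscentAbove h t → Σ ℕ λ x → x ∈ t × h < x
  ascent-entry-above (x ∷ y ∷ r) (inj₁ (h<x , _)) = x , here refl , h<x
  ascent-entry-above (x ∷ y ∷ r) (inj₂ asc) = let (z , z∈ , h<z) = ascent-entry-above (y ∷ r) asc in z , there z∈ , h<z

admissible-insertAfter : ∀ N h c → c ≤ h → h < N → ∀ l →
  Admissible N h l → Admissible (suc N) h (insertAfter (just c) N l)
admissible-insertAfter N h c c≤h h<N (x ∷ t) (refl , p@(_ , _ , bounded) , no-asc)
  with permList-insertAfter N (just c) (x ∷ t) p (permList-∋ N (x ∷ t) c p (≤-<-trans c≤h h<N))
... | p' with x ≟ c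
...   | yes refl = refl , p' , λ asc → no-asc (ascent-behind-max N t (λ y y∈ → bounded y (there y∈)) asc)
...   | no _ = refl , p' , λ asc → no-asc (ascent-insertAfter N c c≤h t (λ y y∈ → bounded y (there y∈)) asc)

predecessor-max-≤ : ∀ N h t → h < N → (∀ y → y ∈ t → y ≤ N) → ¬ AscentAbove h t → N ∈ t →
  Σ ℕ λ w → predecessor N (h ∷ t) ≡ just w × w ≤ h
predecessor-max-≤ N h t h<N bounded no-asc N∈t with h ≟ N
... | yes refl = ⊥-elim (<-irrefl refl h<N)
... | no _ with predecessorAfter-∈ N h t N∈t
...   | (w , eq , _) = w , eq , w≤h
  where
  w<N : w < N
  w<N with predecessorAfter-cases (just h) N t w eq
  ... | inj₁ refl = h<N
  ... | inj₂ (w∈t , w≢N) = ≤∧≢⇒< (bounded w w∈t) w≢N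
  w≤h : w ≤ h
  w≤h with w ≤? h
  ... | yes w≤h = w≤h
  ... | no w≰h = ⊥-elim (no-asc (ascent-behind-head t (ascent-at-predecessor N h t w eq (≰⇒> w≰h) w<N)))

admissible-split : ∀ N h → h < N → ∀ l' → Admissible (suc N) h l' →
  N ∈ l' × Distinct l' × Admissible N h (remove N l') × Σ (Fin (suc h)) λ c → just (toℕ c) ≡ predecessor N l'
admissible-split N h h<N (x ∷ t) (refl , p@(_ , dl , bounded) , no-asc) =
  N∈ , dl , removed , anchor
  where
  N∈ : N ∈ x ∷ t
  N∈ = permList-∋ (suc N) (x ∷ t) N p ≤-refl
  tail-bounded : ∀ y → y ∈ t → y ≤ N
  tail-bounded y y∈ = s≤s⁻¹ (bounded y (there y∈))
  removed : Admissible N x (remove N (x ∷ t))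
  removed with x ≟ N | permList-remove N (x ∷ t) p
  ... | yes refl | _ = ⊥-elim (<-irrefl refl h<N)
  ... | no _ | p' = refl , p' , λ asc → no-asc (ascent-remove N t tail-bounded asc)
  N∈t : N ∈ t
  N∈t with N∈
  ... | here N≡x = ⊥-elim (<-irrefl (sym N≡x) h<N)
  ... | there N∈t = N∈t
  anchor : Σ (Fin (suc x)) λ c → just (toℕ c) ≡ predecessor N (x ∷ t)
  anchor with predecessor-max-≤ N x t h<N tail-bounded no-asc N∈t
  ... | (w , eq , w≤x) = fromℕ< (s≤s w≤x) , trans (cong just (toℕ-fromℕ< (s≤s w≤x))) (sym eq)

admissible-count-base : ∀ h → HasCount (Admissible (suc h) h) (h !)
admissible-count-base h =
  HasCount-map (permList-count h) (h ∷_) (λ { _ _ _ _ refl → refl }) prepend-head drop-head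
  where
  prepend-head : ∀ t → PermList h t → Admissible (suc h) h (h ∷ t)
  prepend-head t (len , dt , bounded) = refl ,
    (cong suc len , ((λ h∈t → <-irrefl refl (bounded h h∈t)) , dt) ,
      λ { x (here refl) → ≤-refl ; x (there x∈) → <-trans (bounded x x∈) ≤-refl }) ,
    λ asc → let (x , x∈ , h<x) = ascent-entry-above t asc in <-asym h<x (bounded x x∈)
  drop-head : ∀ l → Admissible (suc h) h l → Σ (List ℕ) λ t → PermList h t × h ∷ t ≡ l
  drop-head (x ∷ t) (refl , (len , (x∉t , dt) , bounded) , _) = t ,
    (suc-injective len , dt , λ y y∈ → ≤∧≢⇒< (s≤s⁻¹ (bounded y (there y∈))) (λ { refl → x∉t y∈ })) , refl

admissible-count : ∀ h m → HasCount (Admissible (suc (m + h)) h) (h ! * suc h ^ m)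
admissible-count h zero = subst (HasCount _) (sym (*-identityʳ (h !))) (admissible-count-base h)
admissible-count h (suc m) = subst (HasCount _) reassociate
  (insertion-count (suc h) (λ c → just (toℕ c)) N
    (λ c c' eq → toℕ-injective (just-injective eq))
    (λ { (x ∷ t) (_ , p , _) → permList-∌ N (x ∷ t) p })
    (λ { (x ∷ t) c (refl , p , _) → permList-∋ N (x ∷ t) (toℕ c) p (≤-<-trans (s≤s⁻¹ (toℕ<n c)) h<N) })
    (λ l c adm → admissible-insertAfter N h (toℕ c) (s≤s⁻¹ (toℕ<n c)) h<N l adm)
    (admissible-split N h h<N) (admissible-count h m))
  where
  N : ℕ
  N = suc (m + h)
  h<N : h < N
  h<N = s≤s (m≤n+m h m)
  reassociate : suc h * (h ! * suc h ^ m) ≡ h ! * suc h ^ suc m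
  reassociate = begin
    suc h * (h ! * suc h ^ m) ≡⟨ *-assoc (suc h) (h !) (suc h ^ m) ⟨
    suc h * h ! * suc h ^ m   ≡⟨ cong (_* suc h ^ m) (*-comm (suc h) (h !)) ⟩
    h ! * suc h * suc h ^ m   ≡⟨ *-assoc (h !) (suc h) (suc h ^ m) ⟩
    h ! * suc h ^ suc m       ∎

entries : ∀ {n m} → Vec (Fin n) m → List ℕ
entries []v = []
entries (x ∷v xs) = toℕ x ∷ entries xs

entries-length : ∀ {n m} (v : Vec (Fin n) m) → length (entries v) ≡ m
entries-length []v = refl
entries-length (x ∷v xs) = cong suc (entries-length xs)

entries-∈ : ∀ {n m} (v : Vec (Fin n) m) y → y ∈ entries v → Σ (Fin m) λ i → toℕ (lookup v i) ≡ y
entries-∈ (x ∷v xs) y (here y≡x) = fz , sym y≡x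
entries-∈ (x ∷v xs) y (there y∈) = let (i , eq) = entries-∈ xs y y∈ in fs i , eq

lookup-∈-entries : ∀ {n m} (v : Vec (Fin n) m) i → toℕ (lookup v i) ∈ entries v
lookup-∈-entries (x ∷v xs) fz = here refl
lookup-∈-entries (x ∷v xs) (fs i) = there (lookup-∈-entries xs i)

entries-injective : ∀ {n m} (v w : Vec (Fin n) m) → entries v ≡ entries w → v ≡ w
entries-injective []v []v _ = refl
entries-injective (x ∷v xs) (y ∷v ys) eq =
  cong₂ _∷v_ (toℕ-injective (∷-injectiveˡ eq)) (entries-injective xs ys (∷-injectiveʳ eq))

injective⇒distinct : ∀ {n m} (v : Vec (Fin n) m) → Injective _≡_ _≡_ (lookup v) → Distinct (entries v)
injective⇒distinct []v inj = tt
injective⇒distinct (x ∷v xs) inj =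
  (λ x∈ → let (i , eq) = entries-∈ xs (toℕ x) x∈ in fs≢fz (inj {fs i} {fz} (toℕ-injective eq))) ,
  injective⇒distinct xs (λ eq → Fin.suc-injective (inj eq))
  where
  fs≢fz : ∀ {k} {i : Fin k} → fs i ≢ fz
  fs≢fz ()

distinct⇒injective : ∀ {n m} (v : Vec (Fin n) m) → Distinct (entries v) → Injective _≡_ _≡_ (lookup v)
distinct⇒injective (x ∷v xs) _ {fz} {fz} _ = refl
distinct⇒injective (x ∷v xs) (x∉ , _) {fz} {fs j} eq =
  ⊥-elim (x∉ (subst (λ z → toℕ z ∈ entries xs) (sym eq) (lookup-∈-entries xs j)))
distinct⇒injective (x ∷v xs) (x∉ , _) {fs i} {fz} eq =
  ⊥-elim (x∉ (subst (λ z → toℕ z ∈ entries xs) eq (lookup-∈-entries xs i)))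
distinct⇒injective (x ∷v xs) (_ , d) {fs i} {fs j} eq = cong fs (distinct⇒injective xs d eq)

fromEntries : ∀ {n} m (l : List ℕ) → length l ≡ m → (∀ x → x ∈ l → x < n) →
  Σ (Vec (Fin n) m) λ v → entries v ≡ l
fromEntries zero [] _ _ = []v , refl
fromEntries (suc m) (x ∷ l) len bounded =
  let (v , eq) = fromEntries m l (suc-injective len) (λ y y∈ → bounded y (there y∈))
  in (fromℕ< (bounded x (here refl)) ∷v v) , cong₂ _∷_ (toℕ-fromℕ< _) eq

ascent-at : ∀ {n h m} (xs : Vec (Fin n) m) i j → toℕ j ≡ suc (toℕ i) →
  h < toℕ (lookup xs i) → toℕ (lookup xs i) < toℕ (lookup xs j) → AscentAbove h (entries xs)
ascent-at (y ∷v (z ∷v zs)) fz (fs fz) _ h<y y<z = inj₁ (h<y , y<z)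
ascent-at (y ∷v (z ∷v zs)) fz (fs (fs j)) () _ _
ascent-at (y ∷v xs) (fs i) fz () _ _
ascent-at (y ∷v (z ∷v zs)) (fs i) (fs j) j≡i+1 h<y y<z = inj₂ (ascent-at (z ∷v zs) i j (suc-injective j≡i+1) h<y y<z)

ascent-position : ∀ {n h m} (xs : Vec (Fin n) m) → AscentAbove h (entries xs) →
  Σ (Fin m) λ i → Σ (Fin m) λ j → toℕ j ≡ suc (toℕ i) ×
    h < toℕ (lookup xs i) × toℕ (lookup xs i) < toℕ (lookup xs j)
ascent-position (y ∷v (z ∷v zs)) (inj₁ (h<y , y<z)) = fz , fs fz , refl , h<y , y<z
ascent-position (y ∷v (z ∷v zs)) (inj₂ asc) =
  let (i , j , j≡i+1 , h<xi , xi<xj) = ascent-position (z ∷v zs) asc in fs i , fs j , cong suc j≡i+1 , h<xi , xi<xj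

ext-at-0 : ∀ {m N key f u} → Ext m N key f 0 u → u ≡ 0
ext-at-0 ext-zero = refl

ext-at : ∀ {m N f x u} (a : Fin m) → x ≡ suc (toℕ a) → Ext m N toℕ f x u → u ≡ f a
ext-at a () ext-zero
ext-at a eq ext-last = ⊥-elim (<-irrefl (sym (suc-injective eq)) (toℕ<n a))
ext-at {f = f} a eq (ext-mid b) = cong f (toℕ-injective (suc-injective eq))

strictMono-⇔ : ∀ {m} (F : Fin m → ℕ) → (∀ a b → toℕ a < toℕ b → F a < F b) →
  ∀ a b → (F a < F b) ⇔ (toℕ a < toℕ b)
strictMono-⇔ F mono a b = mk⇔ reflect (mono a b)
  where
  reflect : F a < F b → toℕ a < toℕ b
  reflect Fa<Fb with <-cmp (toℕ a) (toℕ b)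
  ... | tri< a<b _ _ = a<b
  ... | tri≈ _ a≡b _ = ⊥-elim (<-irrefl (cong F (toℕ-injective a≡b)) Fa<Fb)
  ... | tri> _ _ b<a = ⊥-elim (<-asym Fa<Fb (mono b a b<a))

increasing₃ : (F : Fin 3 → ℕ) → F fz < F (fs fz) → F (fs fz) < F (fs (fs fz)) → ∀ a b → toℕ a < toℕ b → F a < F b
increasing₃ F p q fz (fs fz) _ = p
increasing₃ F p q fz (fs (fs fz)) _ = <-trans p q
increasing₃ F p q (fs fz) (fs (fs fz)) _ = q
increasing₃ F p q fz fz ()
increasing₃ F p q (fs fz) fz ()
increasing₃ F p q (fs fz) (fs fz) (s≤s ())
increasing₃ F p q (fs (fs fz)) fz ()
increasing₃ F p q (fs (fs fz)) (fs fz) (s≤s ())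
increasing₃ F p q (fs (fs fz)) (fs (fs fz)) (s≤s (s≤s ()))

σ123 : Vec (Fin 3) 3
σ123 = BiVincular.σ p123

σ123-identity : ∀ a → lookup σ123 a ≡ a
σ123-identity fz = refl
σ123-identity (fs fz) = refl
σ123-identity (fs (fs fz)) = refl

order-123 : (F : Fin 3 → ℕ) → F fz < F (fs fz) → F (fs fz) < F (fs (fs fz)) →
  ∀ a b → (F a < F b) ⇔ (toℕ (lookup σ123 a) < toℕ (lookup σ123 b))
order-123 F p q a b = subst₂ (λ i j → (F a < F b) ⇔ (toℕ i < toℕ j))
  (sym (σ123-identity a)) (sym (σ123-identity b)) (strictMono-⇔ F (increasing₃ F p q) a b)

-- π = x xs contains (123,{0,2},∅) iff its tail has an ascent above x: the
-- occurrence must use the first entry and two adjacent later ones.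
module _ {n : ℕ} (x : Fin (suc n)) (xs : Vec (Fin (suc n)) n) where
  private
    π : Vec (Fin (suc n)) (suc n)
    π = x ∷v xs

  ascent-from-occurrence : (p₀ p₁ p₂ : Fin (suc n)) → p₀ ≡ fz → 0 < toℕ p₁ → toℕ p₂ ≡ suc (toℕ p₁) →
    toℕ (lookup π p₀) < toℕ (lookup π p₁) → toℕ (lookup π p₁) < toℕ (lookup π p₂) →
    AscentAbove (toℕ x) (entries xs)
  ascent-from-occurrence .fz (fs i) (fs j) refl _ j≡i+1 = ascent-at xs i j (suc-injective j≡i+1)
  ascent-from-occurrence .fz (fs i) fz refl _ ()
  ascent-from-occurrence .fz fz _ refl () _

  contains⇒ascent : Contains π p123 → AscentAbove (toℕ x) (entries xs)
  contains⇒ascent (pos , mono , ord , adjacent , _) =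
    ascent-from-occurrence (pos fz) (pos (fs fz)) (pos (fs (fs fz)))
      (toℕ-injective first-at-0)
      (subst (_< toℕ (pos (fs fz))) first-at-0 (mono fz (fs fz) (s≤s z≤n)))
      (suc-injective last-adjacent)
      (Equivalence.from (ord fz (fs fz)) (s≤s z≤n))
      (Equivalence.from (ord (fs fz) (fs (fs fz))) (s≤s (s≤s z≤n)))
    where
    first-at-0 : toℕ (pos fz) ≡ 0
    first-at-0 = suc-injective (adjacent 0 (here refl) 0 (suc (toℕ (pos fz))) ext-zero (ext-mid fz))
    last-adjacent : suc (toℕ (pos (fs (fs fz)))) ≡ suc (suc (toℕ (pos (fs fz))))
    last-adjacent = adjacent 2 (there (here refl)) _ _ (ext-mid (fs fz)) (ext-mid (fs (fs fz)))

  ascent⇒contains : AscentAbove (toℕ x) (entries xs) → Contains π p123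
  ascent⇒contains asc with ascent-position xs asc
  ... | (i , j , j≡i+1 , h<xᵢ , xᵢ<xⱼ) =
    pos , increasing₃ (λ a → toℕ (pos a)) (s≤s z≤n) pos₁<pos₂ ,
    order-123 (λ a → toℕ (lookup π (pos a))) h<xᵢ xᵢ<xⱼ , adjacent , λ _ ()
    where
    pos : Fin 3 → Fin (suc n)
    pos fz = fz
    pos (fs fz) = fs i
    pos (fs (fs fz)) = fs j
    pos₁<pos₂ : suc (toℕ i) < suc (toℕ j)
    pos₁<pos₂ = s≤s (subst (suc (toℕ i) ≤_) (sym j≡i+1) ≤-refl)
    adjacent : ∀ y → y ∈ (0 ∷ 2 ∷ []) → Adjacent (suc (suc n)) toℕ (λ a → suc (toℕ (pos a))) y
    adjacent .0 (here refl) _ _ e₀ e₁ = trans (ext-at fz refl e₁) (cong suc (sym (ext-at-0 e₀)))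
    adjacent .2 (there (here refl)) _ _ e₂ e₃ =
      trans (ext-at (fs (fs fz)) refl e₃)
        (trans (cong (λ z → suc (suc z)) j≡i+1) (cong suc (sym (ext-at (fs fz) refl e₂))))

A-set-count : ∀ h m → HasCount (A-set (suc (m + h)) (suc h)) (h ! * suc h ^ m)
A-set-count h m = HasCount-comap (admissible-count h m) entries
  (λ v w _ _ → entries-injective v w) toAdmissible fromAdmissible
  where
  N : ℕ
  N = suc (m + h)
  toAdmissible : ∀ π → A-set N (suc h) π → Admissible N h (entries π)
  toAdmissible (x ∷v xs) (inj , first , avoids) =
    suc-injective first ,
    (cong suc (entries-length xs) , injective⇒distinct (x ∷v xs) inj ,
      λ y y∈ → let (i , eq) = entries-∈ (x ∷v xs) y y∈ in subst (_< N) eq (toℕ<n _)) ,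
    λ asc → avoids (ascent⇒contains x xs (subst (λ z → AscentAbove z (entries xs)) (sym (suc-injective first)) asc))
  fromAdmissible : ∀ l → Admissible N h l → Σ (Vec (Fin N) N) λ π → A-set N (suc h) π × entries π ≡ l
  fromAdmissible (y ∷ t) (refl , (len , dl , bounded) , no-asc)
    with fromEntries N (y ∷ t) len bounded
  ... | (x ∷v xs , eq) =
    x ∷v xs ,
    (distinct⇒injective (x ∷v xs) (subst Distinct (sym eq) dl) , cong suc (∷-injectiveˡ eq) ,
      λ c → no-asc (subst₂ AscentAbove (∷-injectiveˡ eq) (∷-injectiveʳ eq) (contains⇒ascent x xs c))) ,
    eq

A-set-count-∸ : ∀ n' h → h ≤ n' → HasCount (A-set (suc n') (suc h)) (h ! * suc h ^ (n' ∸ h))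
A-set-count-∸ n' h h≤n' =
  subst (λ z → HasCount (A-set (suc z) (suc h)) (h ! * suc h ^ (n' ∸ h))) (m∸n+n≡m h≤n')
    (A-set-count h (n' ∸ h))

-- For k ≤ n-2 this is the general count; k = n-1 and k = n are its instances
-- with exponent 1 and 0.
mainTheorem11 : (n k : ℕ) → 2 ≤ n → 1 ≤ k → k ≤ n →
    (k ≤ n ∸ 2 → HasCount (A-set n k) (((k ∸ 1) !) * k ^ (n ∸ k)))
    × ((k ≡ n ∸ 1 ⊎ k ≡ n) → HasCount (A-set n k) ((n ∸ 1) !))
mainTheorem11 (suc n') (suc h) _ _ (s≤s h≤n') = (λ _ → A-set-count-∸ n' h h≤n') , top-two
  where
  top-two : (suc h ≡ n' ⊎ suc h ≡ suc n') → HasCount (A-set (suc n') (suc h)) (n' !)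
  top-two (inj₁ refl) = subst (HasCount _) h!*[1+h]¹≡[1+h]! (A-set-count-∸ (suc h) h h≤n')
    where
    h!*[1+h]¹≡[1+h]! : h ! * suc h ^ (suc h ∸ h) ≡ suc h !
    h!*[1+h]¹≡[1+h]! = begin
      h ! * suc h ^ (suc h ∸ h) ≡⟨ cong (λ e → h ! * suc h ^ e) (m+n∸n≡m 1 h) ⟩
      h ! * (suc h * 1)         ≡⟨ cong (h ! *_) (*-identityʳ (suc h)) ⟩
      h ! * suc h               ≡⟨ *-comm (h !) (suc h) ⟩
      suc h !                   ∎
  top-two (inj₂ refl) = subst (HasCount _) h!*[1+h]⁰≡h! (A-set-count-∸ h h h≤n')
    where
    h!*[1+h]⁰≡h! : h ! * suc h ^ (h ∸ h) ≡ h !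
    h!*[1+h]⁰≡h! = trans (cong (λ e → h ! * suc h ^ e) (n∸n≡0 h)) (*-identityʳ (h !))
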